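{- On $\mathcal V$, $B_2^{(1)}B_2^{(0)}=q\,B_2^{(0)}B_2^{(1)}$.
   Context: Plethystic notation: $f[E]$ is determined by $p_i[E]=E$ with every variable raised to the $i$-th power. $X=x_1+\dots+x_N$, $X^{tq}=X(t-1)/(q-1)$; $S_\lambda$ Schur functions, $S_{m,0}=S_m$, $S_0=1$. $\mathcal V$ is the $\mathbb Q[q,t]$-span of $\{S_\lambda[X^{tq}]:\ell(\lambda)\le2\}$; the $\mathbb Q[q,t]$-linear operators $B_2^{(0)},B_2^{(1)}$ on $\mathcal V$ are defined for $m\ge n\ge0$ (Schur functions at $X^{tq}$) by $B_2^{(0)}S_{m,n}=\det\begin{pmatrix}-q^{m+1}S_{m+1}&(1-q^{m+2})S_{m+2}\\-q^nS_n&(1-q^{n+1})S_{n+1}\end{pmatrix}$ and $B_2^{(1)}S_{m,n}=q^{m+n+1}\det\begin{pmatrix}S_{m+1}&(1-q^{m+2})S_{m+2}\\S_n&(1-q^{n+1})S_{n+1}\end{pmatrix}$ (products of Schur functions are expanded into $\mathcal V$ via the Pieri rule). -}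

module Defs where

open import Data.Nat as ℕ using (ℕ; zero; suc; _≡ᵇ_; _∸_)
open import Data.Bool using (Bool; true; false; if_then_else_; _∧_)
open import Data.Product using (_×_; _,_)
open import Data.List using (List; []; _∷_; map; concatMap; upTo; _++_; foldr)
open import Data.Rational as Q using (ℚ; 0ℚ; 1ℚ)
open import Relation.Binary.PropositionalEquality using (_≡_)

-- A polynomial is a finite formal sum of monomials  c · q^i · t^j,
-- represented as a list of (c , i , j).

Mono : Set
Mono = ℚ × ℕ × ℕ

Poly : Set
Poly = List Mono

coeffP : Poly → ℕ → ℕ → ℚ
coeffP []                  i j = 0ℚ
coeffP ((c , a , b) ∷ p)   i j =
  if (a ≡ᵇ i) ∧ (b ≡ᵇ j) then c Q.+ coeffP p i j else coeffP p i j

_≈P_ : Poly → Poly → Set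
p ≈P p' = ∀ i j → coeffP p i j ≡ coeffP p' i j

_+P_ : Poly → Poly → Poly
p +P p' = p ++ p'

_*P_ : Poly → Poly → Poly
p *P p' = concatMap (λ { (c , a , b) → map (λ { (c' , a' , b') → (c Q.* c' , a ℕ.+ a' , b ℕ.+ b') }) p' }) p

-P_ : Poly → Poly
-P p = map (λ { (c , a , b) → (Q.- c , a , b) }) p

constP : ℚ → Poly
constP c = (c , 0 , 0) ∷ []

qpow : ℕ → Poly
qpow k = (1ℚ , k , 0) ∷ []

qP : Poly
qP = qpow 1

oneMinusQ : ℕ → Poly
oneMinusQ k = constP 1ℚ +P (-P qpow k)

-- The module 𝒱: free ℚ[q,t]-module with basis S_{m,n}[X^{tq}], m ≥ n ≥ 0.
-- A basis index (n , d) stands for S_{n+d,n}[X^{tq}]  (so m = n + d ≥ n).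

Basis : Set
Basis = ℕ × ℕ

V : Set
V = List (Poly × Basis)

coeffV : V → Basis → Poly
coeffV []                      b = []
coeffV ((c , (n' , d')) ∷ v) (n , d) =
  if (n' ≡ᵇ n) ∧ (d' ≡ᵇ d) then c +P coeffV v (n , d) else coeffV v (n , d)

_≈V_ : V → V → Set
v ≈V w = ∀ b → coeffV v b ≈P coeffV w b

_·V_ : Poly → V → V
c ·V v = map (λ { (c' , b) → (c *P c' , b) }) v

-- Pieri rule for one-row Schur functions:
--   S_a S_b = Σ_{k=0}^{b} S_{a+b-k,k}   (a ≥ b).
-- With b and a = b + e:  S_{b+e} S_b = Σ_{k=0}^{b} S_{k + (e + 2(b-k)), k}.
pieri : ℕ → ℕ → V
pieri b e = map (λ k → (constP 1ℚ , (k , e ℕ.+ 2 ℕ.* (b ∸ k)))) (upTo (suc b))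

-- The operators on basis elements S_{m,n}, m = n + d:
-- B₂⁽⁰⁾ S_{m,n} = -q^{m+1}(1-q^{n+1}) S_{m+1}S_{n+1} + q^n(1-q^{m+2}) S_{m+2}S_n
-- B₂⁽¹⁾ S_{m,n} = q^{m+n+1}[(1-q^{n+1}) S_{m+1}S_{n+1} - (1-q^{m+2}) S_{m+2}S_n]
-- (S_{m+1}S_{n+1} = pieri (n+1) d ;  S_{m+2}S_n = pieri n (d+2)).

B0basis : Basis → V
B0basis (n , d) =
  ((-P (qpow (m ℕ.+ 1) *P oneMinusQ (n ℕ.+ 1))) ·V pieri (n ℕ.+ 1) d)
  ++ ((qpow n *P oneMinusQ (m ℕ.+ 2)) ·V pieri n (d ℕ.+ 2))
  where m = n ℕ.+ d

B1basis : Basis → V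
B1basis (n , d) =
  ((qpow (m ℕ.+ n ℕ.+ 1) *P oneMinusQ (n ℕ.+ 1)) ·V pieri (n ℕ.+ 1) d)
  ++ ((-P (qpow (m ℕ.+ n ℕ.+ 1) *P oneMinusQ (m ℕ.+ 2))) ·V pieri n (d ℕ.+ 2))
  where m = n ℕ.+ d

linExt : (Basis → V) → V → V
linExt f v = concatMap (λ { (c , b) → c ·V f b }) v

B0 : V → V
B0 = linExt B0basis

B1 : V → V
B1 = linExt B1basis

{-# OPTIONS --safe #-}
module Submission where

-- Pair 𝒱 with functionals f : Basis → ℚ[q,t] by ⟪ f , Σ cᵢ S_{bᵢ} ⟫ = Σ cᵢ f(bᵢ). Taking a coefficient is such a
-- functional and ⟪ f , B v ⟫ = ⟪ f ⋆ B , v ⟫, so it suffices to show f ⋆ B₁ ⋆ B₀ = q · f ⋆ B₀ ⋆ B₁ on every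
-- basis vector S_{m,n}.
--
-- By Pieri, S_{m+1}S_{n+1} = S_{m+2}S_n + S_{m+1,n+1}, so B₀S_{m,n} and B₁S_{m,n} are combinations of S_{m+2}S_n
-- and S_{m+1,n+1}. All terms S_{k+d,k} of a Pieri product S_{b+e}S_b have the same m + n = 2b + e, and on each of
-- them f ⋆ (B₁ + q^{m+n+1}B₀) is q^{m+n+1}(Γ(k+1,d) − Γ(k,d+2)) with Γ(b,e) = (1 − q^b)(1 − q^{b+e}) f(S_{b+e}S_b).
-- The sum telescopes since Γ(0,e) = 0, which expresses f ⋆ B₁ on S_{m+2}S_n through f ⋆ B₀; what is left is a
-- polynomial identity in q, q^n and q^{m−n}.

open import Defs
open import Algebra.Bundles using (CommutativeMonoid; CommutativeRing; RawRing)
import Algebra.Properties.CommutativeSemigroup as CommutativeSemigroupProperties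
import Algebra.Properties.Ring as RingProperties
import Algebra.Solver.Ring as RingSolver
import Algebra.Solver.Ring.AlmostCommutativeRing as ACR
open import Data.Bool using (Bool; true; false; if_then_else_; _∧_)
open import Data.List using (List; []; _∷_; [_]; _++_; map; concatMap; applyUpTo)
import Data.List.Properties as List
open import Data.Maybe using (Maybe; just; nothing)
open import Data.Nat as ℕ using (ℕ; zero; suc; _≡ᵇ_; _∸_)
import Data.Nat.Properties as ℕ
open import Data.Nat.Tactic.RingSolver using (solve-∀)
open import Data.Product using (_×_; _,_)
open import Data.Rational using (ℚ; 0ℚ; 1ℚ)
import Data.Rational.Properties as ℚ
open import Level using (0ℓ)
open import Relation.Binary.PropositionalEquality as ≡ using (_≡_)
open import Relation.Nullary using (yes; no)

module PolynomialRing where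

  open import Data.Rational using (_+_; _*_; -_; _≟_; +-*-rawRing)
  open ≡ using (refl; sym; trans; cong; cong₂)
  open ≡.≡-Reasoning

  ∑ : {A : Set} → List A → (A → ℚ) → ℚ
  ∑ []       f = 0ℚ
  ∑ (x ∷ xs) f = f x + ∑ xs f

  module _ {A : Set} where

    ∑-cong : (xs : List A) {f g : A → ℚ} → (∀ x → f x ≡ g x) → ∑ xs f ≡ ∑ xs g
    ∑-cong []       f≡g = refl
    ∑-cong (x ∷ xs) f≡g = cong₂ _+_ (f≡g x) (∑-cong xs f≡g)

    ∑-zero : (xs : List A) → ∑ xs (λ _ → 0ℚ) ≡ 0ℚ
    ∑-zero []       = refl
    ∑-zero (x ∷ xs) = trans (ℚ.+-identityˡ _) (∑-zero xs)

    ∑-++ : (xs ys : List A) (f : A → ℚ) → ∑ (xs ++ ys) f ≡ ∑ xs f + ∑ ys f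
    ∑-++ []       ys f = sym (ℚ.+-identityˡ _)
    ∑-++ (x ∷ xs) ys f = trans (cong (f x +_) (∑-++ xs ys f)) (sym (ℚ.+-assoc (f x) _ _))

    ∑-+ : (xs : List A) (f g : A → ℚ) → ∑ xs (λ x → f x + g x) ≡ ∑ xs f + ∑ xs g
    ∑-+ []       f g = refl
    ∑-+ (x ∷ xs) f g =
      trans (cong (f x + g x +_) (∑-+ xs f g)) (interchange (f x) (g x) (∑ xs f) (∑ xs g))
      where open CommutativeSemigroupProperties (CommutativeMonoid.commutativeSemigroup ℚ.+-0-commutativeMonoid)

    ∑-*ˡ : (c : ℚ) (xs : List A) (f : A → ℚ) → c * ∑ xs f ≡ ∑ xs (λ x → c * f x)
    ∑-*ˡ c []       f = ℚ.*-zeroʳ c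
    ∑-*ˡ c (x ∷ xs) f = trans (ℚ.*-distribˡ-+ c (f x) _) (cong (c * f x +_) (∑-*ˡ c xs f))

  module _ {A B : Set} where

    ∑-map : (g : A → B) (xs : List A) (f : B → ℚ) → ∑ (map g xs) f ≡ ∑ xs (λ x → f (g x))
    ∑-map g []       f = refl
    ∑-map g (x ∷ xs) f = cong (f (g x) +_) (∑-map g xs f)

    ∑-concatMap : (g : A → List B) (xs : List A) (f : B → ℚ) →
                  ∑ (concatMap g xs) f ≡ ∑ xs (λ x → ∑ (g x) f)
    ∑-concatMap g []       f = refl
    ∑-concatMap g (x ∷ xs) f = trans (∑-++ (g x) _ f) (cong (∑ (g x) f +_) (∑-concatMap g xs f))

    ∑-swap : (xs : List A) (ys : List B) (f : A → B → ℚ) →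
             ∑ xs (λ x → ∑ ys (f x)) ≡ ∑ ys (λ y → ∑ xs (λ x → f x y))
    ∑-swap []       ys f = sym (∑-zero ys)
    ∑-swap (x ∷ xs) ys f = trans (cong (∑ ys (f x) +_) (∑-swap xs ys f)) (sym (∑-+ ys (f x) _))

  monoCoeff : Mono → ℕ → ℕ → ℚ
  monoCoeff (c , a , b) i j = if (a ≡ᵇ i) ∧ (b ≡ᵇ j) then c else 0ℚ

  coeffP-∑ : ∀ p i j → coeffP p i j ≡ ∑ p (λ m → monoCoeff m i j)
  coeffP-∑ []                i j = refl
  coeffP-∑ ((c , a , b) ∷ p) i j with (a ≡ᵇ i) ∧ (b ≡ᵇ j)
  ... | true  = cong (c +_) (coeffP-∑ p i j)
  ... | false = trans (coeffP-∑ p i j) (sym (ℚ.+-identityˡ _))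

  coeffP-+ : ∀ p r i j → coeffP (p +P r) i j ≡ coeffP p i j + coeffP r i j
  coeffP-+ p r i j = begin
    coeffP (p ++ r) i j                          ≡⟨ coeffP-∑ (p ++ r) i j ⟩
    ∑ (p ++ r) (λ m → monoCoeff m i j)           ≡⟨ ∑-++ p r _ ⟩
    ∑ p (λ m → monoCoeff m i j) + ∑ r (λ m → monoCoeff m i j)
      ≡⟨ sym (cong₂ _+_ (coeffP-∑ p i j) (coeffP-∑ r i j)) ⟩
    coeffP p i j + coeffP r i j                  ∎

  coeffP-neg : ∀ p i j → coeffP (-P p) i j ≡ - coeffP p i j
  coeffP-neg []                i j = refl
  coeffP-neg ((c , a , b) ∷ p) i j with (a ≡ᵇ i) ∧ (b ≡ᵇ j)
  ... | true  = trans (cong (- c +_) (coeffP-neg p i j)) (sym (ℚ.neg-distrib-+ c _))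
  ... | false = coeffP-neg p i j

  _·ₘ_ : Mono → Mono → Mono
  (c , a , b) ·ₘ (c' , a' , b') = (c * c' , a ℕ.+ a' , b ℕ.+ b')

  coeffP-* : ∀ p r i j → coeffP (p *P r) i j ≡ ∑ p (λ m → ∑ r (λ m' → monoCoeff (m ·ₘ m') i j))
  coeffP-* p r i j = begin
    coeffP (concatMap (λ m → map (m ·ₘ_) r) p) i j
      ≡⟨ coeffP-∑ (p *P r) i j ⟩
    ∑ (concatMap (λ m → map (m ·ₘ_) r) p) (λ m → monoCoeff m i j)
      ≡⟨ ∑-concatMap (λ m → map (m ·ₘ_) r) p _ ⟩
    ∑ p (λ m → ∑ (map (m ·ₘ_) r) (λ m″ → monoCoeff m″ i j))
      ≡⟨ ∑-cong p (λ m → ∑-map (m ·ₘ_) r _) ⟩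
    ∑ p (λ m → ∑ r (λ m' → monoCoeff (m ·ₘ m') i j)) ∎

  -- `_≤ᵇ_` of Data.Nat goes through the builtin `_<ᵇ_` and does not reduce on `suc a ≤ᵇ suc i`.
  _≤ᵇ_ : ℕ → ℕ → Bool
  zero  ≤ᵇ i     = true
  suc a ≤ᵇ zero  = false
  suc a ≤ᵇ suc i = a ≤ᵇ i

  +-≡ᵇ : ∀ a a' i → (a ℕ.+ a' ≡ᵇ i) ≡ (if a ≤ᵇ i then a' ≡ᵇ i ∸ a else false)
  +-≡ᵇ zero    a' i       = refl
  +-≡ᵇ (suc a) a' zero    = refl
  +-≡ᵇ (suc a) a' (suc i) = +-≡ᵇ a a' i

  shift : Mono → (ℕ → ℕ → ℚ) → ℕ → ℕ → ℚ
  shift (c , a , b) F i j = if (a ≤ᵇ i) ∧ (b ≤ᵇ j) then c * F (i ∸ a) (j ∸ b) else 0ℚ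

  monoCoeff-·ₘ : ∀ m m' i j → monoCoeff (m ·ₘ m') i j ≡ shift m (monoCoeff m') i j
  monoCoeff-·ₘ (c , a , b) (c' , a' , b') i j rewrite +-≡ᵇ a a' i | +-≡ᵇ b b' j
    with a ≤ᵇ i | b ≤ᵇ j | a' ≡ᵇ i ∸ a | b' ≡ᵇ j ∸ b
  ... | false | _     | _     | _     = refl
  ... | true  | false | true  | _     = refl
  ... | true  | false | false | _     = refl
  ... | true  | true  | true  | true  = refl
  ... | true  | true  | true  | false = sym (ℚ.*-zeroʳ c)
  ... | true  | true  | false | _     = sym (ℚ.*-zeroʳ c)

  ∑-·ₘ-shift : ∀ m r i j → ∑ r (λ m' → monoCoeff (m ·ₘ m') i j) ≡ shift m (coeffP r) i j
  ∑-·ₘ-shift m@(c , a , b) r i j =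
    trans (∑-cong r (λ m' → monoCoeff-·ₘ m m' i j)) (∑-shift ((a ≤ᵇ i) ∧ (b ≤ᵇ j)))
    where
    ∑-shift : ∀ fits → ∑ r (λ m' → if fits then c * monoCoeff m' (i ∸ a) (j ∸ b) else 0ℚ)
                     ≡ (if fits then c * coeffP r (i ∸ a) (j ∸ b) else 0ℚ)
    ∑-shift true  = trans (sym (∑-*ˡ c r _)) (cong (c *_) (sym (coeffP-∑ r (i ∸ a) (j ∸ b))))
    ∑-shift false = ∑-zero r

  shift-cong : ∀ m {F G : ℕ → ℕ → ℚ} → (∀ i j → F i j ≡ G i j) → ∀ i j → shift m F i j ≡ shift m G i j
  shift-cong (c , a , b) F≡G i j with (a ≤ᵇ i) ∧ (b ≤ᵇ j)
  ... | true  = cong (c *_) (F≡G (i ∸ a) (j ∸ b))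
  ... | false = refl

  ·ₘ-comm : ∀ m m' → m ·ₘ m' ≡ m' ·ₘ m
  ·ₘ-comm (c , a , b) (c' , a' , b') rewrite ℚ.*-comm c c' | ℕ.+-comm a a' | ℕ.+-comm b b' = refl

  ·ₘ-assoc : ∀ m m' m″ → (m ·ₘ m') ·ₘ m″ ≡ m ·ₘ (m' ·ₘ m″)
  ·ₘ-assoc (c , a , b) (c' , a' , b') (c″ , a″ , b″)
    rewrite ℚ.*-assoc c c' c″ | ℕ.+-assoc a a' a″ | ℕ.+-assoc b b' b″ = refl

  ·ₘ-identityˡ : ∀ m → (1ℚ , 0 , 0) ·ₘ m ≡ m
  ·ₘ-identityˡ (c , a , b) rewrite ℚ.*-identityˡ c = refl

  -- A record rather than `_≈P_` itself, so that both sides can be inferred from a proof.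
  infix 4 _≈_
  record _≈_ (p r : Poly) : Set where
    constructor mk≈
    field coeff-≡ : p ≈P r
  open _≈_ public

  ≈-refl : ∀ {p} → p ≈ p
  ≈-refl = mk≈ λ i j → refl

  ≈-sym : ∀ {p r} → p ≈ r → r ≈ p
  ≈-sym (mk≈ e) = mk≈ λ i j → sym (e i j)

  ≈-trans : ∀ {p r u} → p ≈ r → r ≈ u → p ≈ u
  ≈-trans (mk≈ e) (mk≈ f) = mk≈ λ i j → trans (e i j) (f i j)

  -- Opaque, so that the ring solver compares normal forms syntactically instead of unfolding list operations.
  infixl 6 _⊕_
  infixl 7 _⊗_
  infix  8 ⊖_
  opaque
    _⊕_ _⊗_ : Poly → Poly → Poly
    _⊕_ = _+P_
    _⊗_ = _*P_

    ⊖_ : Poly → Poly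
    ⊖_ = -P_

  opaque
    unfolding _⊕_ _⊗_ ⊖_
    +-cong : ∀ {p p' r r'} → p ≈ p' → r ≈ r' → p ⊕ r ≈ p' ⊕ r'
    +-cong {p} {p'} {r} {r'} (mk≈ e) (mk≈ f) = mk≈ λ i j → begin
      coeffP (p ⊕ r) i j           ≡⟨ coeffP-+ p r i j ⟩
      coeffP p i j + coeffP r i j   ≡⟨ cong₂ _+_ (e i j) (f i j) ⟩
      coeffP p' i j + coeffP r' i j ≡⟨ coeffP-+ p' r' i j ⟨
      coeffP (p' ⊕ r') i j         ∎

    +-assoc : ∀ p r u → (p ⊕ r) ⊕ u ≈ p ⊕ (r ⊕ u)
    +-assoc p r u = mk≈ λ i j → cong (λ s → coeffP s i j) (List.++-assoc p r u)

    +-identityˡ : ∀ p → [] ⊕ p ≈ p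
    +-identityˡ p = ≈-refl

    +-identityʳ : ∀ p → p ⊕ [] ≈ p
    +-identityʳ p = mk≈ λ i j → trans (coeffP-+ p [] i j) (ℚ.+-identityʳ _)

    +-comm : ∀ p r → p ⊕ r ≈ r ⊕ p
    +-comm p r = mk≈ λ i j → begin
      coeffP (p ⊕ r) i j         ≡⟨ coeffP-+ p r i j ⟩
      coeffP p i j + coeffP r i j ≡⟨ ℚ.+-comm (coeffP p i j) (coeffP r i j) ⟩
      coeffP r i j + coeffP p i j ≡⟨ coeffP-+ r p i j ⟨
      coeffP (r ⊕ p) i j         ∎

    neg-cong : ∀ {p r} → p ≈ r → ⊖ p ≈ ⊖ r
    neg-cong {p} {r} (mk≈ e) = mk≈ λ i j →
      trans (coeffP-neg p i j) (trans (cong -_ (e i j)) (sym (coeffP-neg r i j)))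

    +-inverseˡ : ∀ p → ⊖ p ⊕ p ≈ []
    +-inverseˡ p = mk≈ λ i j → begin
      coeffP (⊖ p ⊕ p) i j          ≡⟨ coeffP-+ (⊖ p) p i j ⟩
      coeffP (⊖ p) i j + coeffP p i j ≡⟨ cong (_+ coeffP p i j) (coeffP-neg p i j) ⟩
      - coeffP p i j + coeffP p i j    ≡⟨ ℚ.+-inverseˡ (coeffP p i j) ⟩
      0ℚ                               ∎

    +-inverseʳ : ∀ p → p ⊕ ⊖ p ≈ []
    +-inverseʳ p = ≈-trans (+-comm p (⊖ p)) (+-inverseˡ p)

    *-congˡ : ∀ p {r r'} → r ≈ r' → p ⊗ r ≈ p ⊗ r'
    *-congˡ p {r} {r'} (mk≈ e) = mk≈ λ i j → begin
      coeffP (p ⊗ r) i j                                  ≡⟨ coeffP-* p r i j ⟩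
      ∑ p (λ m → ∑ r (λ m' → monoCoeff (m ·ₘ m') i j))     ≡⟨ ∑-cong p (λ m → ∑-·ₘ-shift m r i j) ⟩
      ∑ p (λ m → shift m (coeffP r) i j)                   ≡⟨ ∑-cong p (λ m → shift-cong m e i j) ⟩
      ∑ p (λ m → shift m (coeffP r') i j)                  ≡⟨ ∑-cong p (λ m → ∑-·ₘ-shift m r' i j) ⟨
      ∑ p (λ m → ∑ r' (λ m' → monoCoeff (m ·ₘ m') i j))    ≡⟨ coeffP-* p r' i j ⟨
      coeffP (p ⊗ r') i j                                 ∎

    *-comm : ∀ p r → p ⊗ r ≈ r ⊗ p
    *-comm p r = mk≈ λ i j → begin
      coeffP (p ⊗ r) i j                               ≡⟨ coeffP-* p r i j ⟩
      ∑ p (λ m → ∑ r (λ m' → monoCoeff (m ·ₘ m') i j))  ≡⟨ ∑-swap p r _ ⟩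
      ∑ r (λ m' → ∑ p (λ m → monoCoeff (m ·ₘ m') i j))  ≡⟨ ∑-cong r (λ m' → ∑-cong p (λ m →
                                                             cong (λ m″ → monoCoeff m″ i j) (·ₘ-comm m m'))) ⟩
      ∑ r (λ m' → ∑ p (λ m → monoCoeff (m' ·ₘ m) i j))  ≡⟨ coeffP-* r p i j ⟨
      coeffP (r ⊗ p) i j                               ∎

    *-cong : ∀ {p p' r r'} → p ≈ p' → r ≈ r' → p ⊗ r ≈ p' ⊗ r'
    *-cong {p} {p'} {r} {r'} e f =
      ≈-trans (*-congˡ p f) (≈-trans (*-comm p r') (≈-trans (*-congˡ r' e) (*-comm r' p')))

    *-assoc : ∀ p r u → (p ⊗ r) ⊗ u ≈ p ⊗ (r ⊗ u)
    *-assoc p r u = mk≈ λ i j → begin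
      coeffP ((p ⊗ r) ⊗ u) i j
        ≡⟨ coeffP-* (p ⊗ r) u i j ⟩
      ∑ (concatMap (λ m → map (m ·ₘ_) r) p) (λ m → ∑ u (λ m″ → monoCoeff (m ·ₘ m″) i j))
        ≡⟨ ∑-concatMap _ p _ ⟩
      ∑ p (λ m → ∑ (map (m ·ₘ_) r) (λ m' → ∑ u (λ m″ → monoCoeff (m' ·ₘ m″) i j)))
        ≡⟨ ∑-cong p (λ m → ∑-map (m ·ₘ_) r _) ⟩
      ∑ p (λ m → ∑ r (λ m' → ∑ u (λ m″ → monoCoeff ((m ·ₘ m') ·ₘ m″) i j)))
        ≡⟨ ∑-cong p (λ m → ∑-cong r (λ m' → ∑-cong u (λ m″ →
             cong (λ x → monoCoeff x i j) (·ₘ-assoc m m' m″)))) ⟩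
      ∑ p (λ m → ∑ r (λ m' → ∑ u (λ m″ → monoCoeff (m ·ₘ (m' ·ₘ m″)) i j)))
        ≡⟨ ∑-cong p (λ m → trans (∑-concatMap _ r _) (∑-cong r (λ m' → ∑-map (m' ·ₘ_) u _))) ⟨
      ∑ p (λ m → ∑ (r ⊗ u) (λ x → monoCoeff (m ·ₘ x) i j))
        ≡⟨ coeffP-* p (r ⊗ u) i j ⟨
      coeffP (p ⊗ (r ⊗ u)) i j ∎

    *-identityˡ : ∀ p → constP 1ℚ ⊗ p ≈ p
    *-identityˡ p = mk≈ λ i j → begin
      coeffP (constP 1ℚ ⊗ p) i j                          ≡⟨ coeffP-* (constP 1ℚ) p i j ⟩
      ∑ p (λ m → monoCoeff ((1ℚ , 0 , 0) ·ₘ m) i j) + 0ℚ  ≡⟨ ℚ.+-identityʳ _ ⟩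
      ∑ p (λ m → monoCoeff ((1ℚ , 0 , 0) ·ₘ m) i j)
        ≡⟨ ∑-cong p (λ m → cong (λ x → monoCoeff x i j) (·ₘ-identityˡ m)) ⟩
      ∑ p (λ m → monoCoeff m i j)                         ≡⟨ coeffP-∑ p i j ⟨
      coeffP p i j                                        ∎

    *-identityʳ : ∀ p → p ⊗ constP 1ℚ ≈ p
    *-identityʳ p = ≈-trans (*-comm p (constP 1ℚ)) (*-identityˡ p)

    *-distribˡ-+ : ∀ p r u → p ⊗ (r ⊕ u) ≈ (p ⊗ r) ⊕ (p ⊗ u)
    *-distribˡ-+ p r u = mk≈ λ i j → begin
      coeffP (p ⊗ (r ⊕ u)) i j
        ≡⟨ coeffP-* p (r ++ u) i j ⟩
      ∑ p (λ m → ∑ (r ++ u) (λ m' → monoCoeff (m ·ₘ m') i j))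
        ≡⟨ ∑-cong p (λ m → ∑-++ r u _) ⟩
      ∑ p (λ m → ∑ r (λ m' → monoCoeff (m ·ₘ m') i j) + ∑ u (λ m' → monoCoeff (m ·ₘ m') i j))
        ≡⟨ ∑-+ p _ _ ⟩
      ∑ p (λ m → ∑ r (λ m' → monoCoeff (m ·ₘ m') i j)) + ∑ p (λ m → ∑ u (λ m' → monoCoeff (m ·ₘ m') i j))
        ≡⟨ cong₂ _+_ (coeffP-* p r i j) (coeffP-* p u i j) ⟨
      coeffP (p ⊗ r) i j + coeffP (p ⊗ u) i j
        ≡⟨ coeffP-+ (p ⊗ r) (p ⊗ u) i j ⟨
      coeffP ((p ⊗ r) ⊕ (p ⊗ u)) i j ∎

    *-distribʳ-+ : ∀ p r u → (r ⊕ u) ⊗ p ≈ (r ⊗ p) ⊕ (u ⊗ p)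
    *-distribʳ-+ p r u = mk≈ λ i j → cong (λ s → coeffP s i j) (List.concatMap-++ (λ m → map (m ·ₘ_) p) r u)

  polyRing : CommutativeRing _ _
  polyRing = record
    { Carrier = Poly ; _≈_ = _≈_ ; _+_ = _⊕_ ; _*_ = _⊗_ ; -_ = ⊖_ ; 0# = [] ; 1# = constP 1ℚ
    ; isCommutativeRing = record
      { isRing = record
        { +-isAbelianGroup = record
          { isGroup = record
            { isMonoid = record
              { isSemigroup = record
                { isMagma = record
                  { isEquivalence = record { refl = ≈-refl ; sym = ≈-sym ; trans = ≈-trans }
                  ; ∙-cong = +-cong }
                ; assoc = +-assoc }
              ; identity = +-identityˡ , +-identityʳ }
            ; inverse = +-inverseˡ , +-inverseʳ
            ; ⁻¹-cong = neg-cong }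
          ; comm = +-comm }
        ; *-cong = *-cong
        ; *-assoc = *-assoc
        ; *-identity = *-identityˡ , *-identityʳ
        ; distrib = *-distribˡ-+ , *-distribʳ-+ }
      ; *-comm = *-comm } }

  opaque
    unfolding _⊕_ _⊗_ ⊖_

    constP-+ : ∀ a b → constP (a + b) ≈ constP a ⊕ constP b
    constP-+ a b = mk≈ λ i j → at-origin ((0 ≡ᵇ i) ∧ (0 ≡ᵇ j))
      where
      at-origin : ∀ at0 → (if at0 then a + b + 0ℚ else 0ℚ)
                      ≡ (if at0 then a + (if at0 then b + 0ℚ else 0ℚ) else (if at0 then b + 0ℚ else 0ℚ))
      at-origin true  = ℚ.+-assoc a b 0ℚ
      at-origin false = refl

    constP-* : ∀ a b → constP (a * b) ≈ constP a ⊗ constP b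
    constP-* a b = ≈-refl

    constP-neg : ∀ a → constP (- a) ≈ ⊖ constP a
    constP-neg a = ≈-refl

    constP-0 : constP 0ℚ ≈ []
    constP-0 = mk≈ λ i j → at-origin ((0 ≡ᵇ i) ∧ (0 ≡ᵇ j))
      where
      at-origin : ∀ at0 → (if at0 then 0ℚ + 0ℚ else 0ℚ) ≡ 0ℚ
      at-origin true  = refl
      at-origin false = refl

  polyACR : ACR.AlmostCommutativeRing _ _
  polyACR = ACR.fromCommutativeRing polyRing

  constP-homomorphism : +-*-rawRing ACR.-Raw-AlmostCommutative⟶ polyACR
  constP-homomorphism = record
    { ⟦_⟧ = constP ; +-homo = constP-+ ; *-homo = constP-* ; -‿homo = constP-neg
    ; 0-homo = constP-0 ; 1-homo = ≈-refl }

  constP-≟ : ∀ a b → Maybe (constP a ≈ constP b)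
  constP-≟ a b with a ≟ b
  ... | yes refl = just ≈-refl
  ... | no _     = nothing

  open RingSolver +-*-rawRing polyACR constP-homomorphism constP-≟ public

open PolynomialRing
  using (polyRing; coeff-≡; _⊕_; _⊗_; ⊖_; Polynomial; con; _:+_; _:*_; :-_; _:-_; _:=_; solve)

-- The coefficients of S_{m+1}S_{n+1} and S_{m+2}S_n in B₂⁽⁰⁾S_{m,n} and B₂⁽¹⁾S_{m,n}, as functions of N = q^n and
-- D = q^(m−n). They are defined over any raw ring so that the ring solver's syntax can use the same definitions.
module PieriCoefficients (R : RawRing 0ℓ 0ℓ) (q : RawRing.Carrier R) where
  open RawRing R

  infixl 6 _-_
  _-_ : Carrier → Carrier → Carrier
  x - y = x + - y

  b0₁ b0₂ b1₁ b1₂ : Carrier → Carrier → Carrier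
  b0₁ N D = - (N * D * q * (1# - N * q))
  b0₂ N D = N * (1# - N * D * (q * q))
  b1₁ N D = N * D * N * q * (1# - N * q)
  b1₂ N D = - (N * D * N * q * (1# - N * D * (q * q)))

open CommutativeRing polyRing

module _ where
  open ≡.≡-Reasoning

  applyUpTo-cong : ∀ {A : Set} (f g : ℕ → A) n → (∀ {k} → k ℕ.< n → f k ≡ g k) → applyUpTo f n ≡ applyUpTo g n
  applyUpTo-cong f g zero    f≡g = ≡.refl
  applyUpTo-cong f g (suc n) f≡g =
    ≡.cong₂ _∷_ (f≡g (ℕ.s≤s ℕ.z≤n))
                (applyUpTo-cong (λ k → f (suc k)) (λ k → g (suc k)) n (λ k<n → f≡g (ℕ.s≤s k<n)))

  pieri-zero : ∀ e → pieri 0 e ≡ [ (1# , (0 , e)) ]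
  pieri-zero e = ≡.cong (λ e' → [ (1# , (0 , e')) ]) (ℕ.+-identityʳ e)

  pieri-suc : ∀ b e → pieri (suc b) e ≡ pieri b (e ℕ.+ 2) ++ [ (1# , (suc b , e)) ]
  pieri-suc b e = begin
    pieri (suc b) e                       ≡⟨ List.map-upTo F (suc (suc b)) ⟩
    applyUpTo F (suc (suc b))             ≡⟨ List.applyUpTo-∷ʳ F (suc b) ⟨
    applyUpTo F (suc b) ++ [ F (suc b) ]  ≡⟨ ≡.cong₂ (λ xs x → xs ++ [ x ]) (applyUpTo-cong F G (suc b) F≡G) F-last ⟩
    applyUpTo G (suc b) ++ [ last ]       ≡⟨ ≡.cong (_++ [ last ]) (List.map-upTo G (suc b)) ⟨
    pieri b (e ℕ.+ 2) ++ [ last ]         ∎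
    where
    F G : ℕ → Poly × Basis
    F k = (1# , (k , e ℕ.+ 2 ℕ.* (suc b ∸ k)))
    G k = (1# , (k , (e ℕ.+ 2) ℕ.+ 2 ℕ.* (b ∸ k)))
    shift-two : ∀ x → e ℕ.+ 2 ℕ.* suc x ≡ (e ℕ.+ 2) ℕ.+ 2 ℕ.* x
    shift-two x = ≡.trans (≡.cong (e ℕ.+_) (ℕ.*-suc 2 x)) (≡.sym (ℕ.+-assoc e 2 (2 ℕ.* x)))
    F≡G : ∀ {k} → k ℕ.< suc b → F k ≡ G k
    F≡G {k} (ℕ.s≤s k≤b) = ≡.cong (λ x → (1# , (k , x)))
      (≡.trans (≡.cong (λ y → e ℕ.+ 2 ℕ.* y) (ℕ.+-∸-assoc 1 k≤b)) (shift-two (b ∸ k)))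
    last : Poly × Basis
    last = (1# , (suc b , e))
    F-last : F (suc b) ≡ last
    F-last = ≡.cong (λ x → (1# , (suc b , x)))
      (≡.trans (≡.cong (λ y → e ℕ.+ 2 ℕ.* y) (ℕ.n∸n≡0 b)) (ℕ.+-identityʳ e))

open import Relation.Binary.Reasoning.Setoid setoid

q : Poly
q = qP

open PieriCoefficients rawRing q using (b0₁; b0₂; b1₁; b1₂)

syntaxRing : ℕ → RawRing 0ℓ 0ℓ
syntaxRing n = record
  { Carrier = Polynomial n ; _≈_ = _≡_ ; _+_ = _:+_ ; _*_ = _:*_ ; -_ = :-_ ; 0# = con 0ℚ ; 1# = con 1ℚ }

module _ {n : ℕ} (q : Polynomial n) where
  open PieriCoefficients (syntaxRing n) q public
    using () renaming (b0₁ to :b0₁; b0₂ to :b0₂; b1₁ to :b1₁; b1₂ to :b1₂)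

-- In this block the ring operations compute on the explicit lists `qpow k` and `constP c`, so exponent arithmetic
-- and the coefficients of `B0basis` and `B1basis` hold by `refl`.
opaque
  unfolding _⊕_ _⊗_ ⊖_

  +P≡+ : ∀ p r → p +P r ≡ p + r
  +P≡+ p r = ≡.refl

  *P≡* : ∀ p r → p *P r ≡ p * r
  *P≡* p r = ≡.refl

  qpow-suc : ∀ a → qpow (suc a) ≡ q * qpow a
  qpow-suc a = ≡.refl

  qpow-+2 : ∀ a → qpow (a ℕ.+ 2) ≡ qpow a * (q * q)
  qpow-+2 a = ≡.refl

  qpow-k+k+d+1 : ∀ k d → qpow (k ℕ.+ k ℕ.+ d ℕ.+ 1) ≡ qpow k * qpow k * qpow d * q
  qpow-k+k+d+1 k d = ≡.refl

  B0basis-≡ : ∀ n d → B0basis (n , d) ≡ (b0₁ (qpow n) (qpow d) ·V pieri (n ℕ.+ 1) d)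
                                         ++ (b0₂ (qpow n) (qpow d) ·V pieri n (d ℕ.+ 2))
  B0basis-≡ n d = ≡.refl

  B1basis-≡ : ∀ n d → B1basis (n , d) ≡ (b1₁ (qpow n) (qpow d) ·V pieri (n ℕ.+ 1) d)
                                         ++ (b1₂ (qpow n) (qpow d) ·V pieri n (d ℕ.+ 2))
  B1basis-≡ n d = ≡.refl

infix 4 ⟪_,_⟫
⟪_,_⟫ : (Basis → Poly) → V → Poly
⟪ f , [] ⟫          = 0#
⟪ f , (c , x) ∷ v ⟫ = c * f x + ⟪ f , v ⟫

infixl 5 _⋆_
_⋆_ : (Basis → Poly) → (Basis → V) → Basis → Poly
(f ⋆ g) x = ⟪ f , g x ⟫

⟪⟫-cong : ∀ {f g} v → (∀ x → f x ≈ g x) → ⟪ f , v ⟫ ≈ ⟪ g , v ⟫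
⟪⟫-cong []            f≈g = refl
⟪⟫-cong ((c , x) ∷ v) f≈g = +-cong (*-congˡ (f≈g x)) (⟪⟫-cong v f≈g)

⟪⟫-+ˡ : ∀ f g v → ⟪ (λ x → f x + g x) , v ⟫ ≈ ⟪ f , v ⟫ + ⟪ g , v ⟫
⟪⟫-+ˡ f g []            = sym (+-identityʳ 0#)
⟪⟫-+ˡ f g ((a , x) ∷ v) = begin
  a * (f x + g x) + ⟪ (λ x → f x + g x) , v ⟫     ≈⟨ +-congˡ (⟪⟫-+ˡ f g v) ⟩
  a * (f x + g x) + (⟪ f , v ⟫ + ⟪ g , v ⟫)
    ≈⟨ solve 5 (λ a fx gx F G → a :* (fx :+ gx) :+ (F :+ G) := (a :* fx :+ F) :+ (a :* gx :+ G))
               refl a (f x) (g x) ⟪ f , v ⟫ ⟪ g , v ⟫ ⟩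
  (a * f x + ⟪ f , v ⟫) + (a * g x + ⟪ g , v ⟫)   ∎

⟪⟫-*ˡ : ∀ c f v → ⟪ (λ x → c * f x) , v ⟫ ≈ c * ⟪ f , v ⟫
⟪⟫-*ˡ c f []            = sym (zeroʳ c)
⟪⟫-*ˡ c f ((a , x) ∷ v) = begin
  a * (c * f x) + ⟪ (λ x → c * f x) , v ⟫    ≈⟨ +-congˡ (⟪⟫-*ˡ c f v) ⟩
  a * (c * f x) + c * ⟪ f , v ⟫              ≈⟨ solve 4 (λ a c fx F → a :* (c :* fx) :+ c :* F := c :* (a :* fx :+ F))
                                                   refl a c (f x) ⟪ f , v ⟫ ⟩
  c * (a * f x + ⟪ f , v ⟫)                  ∎

⟪⟫-++ : ∀ f v w → ⟪ f , v ++ w ⟫ ≈ ⟪ f , v ⟫ + ⟪ f , w ⟫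
⟪⟫-++ f []            w = sym (+-identityˡ _)
⟪⟫-++ f ((c , x) ∷ v) w = trans (+-congˡ (⟪⟫-++ f v w)) (sym (+-assoc _ _ _))

⟪⟫-·V : ∀ f c v → ⟪ f , c ·V v ⟫ ≈ c * ⟪ f , v ⟫
⟪⟫-·V f c []             = sym (zeroʳ c)
⟪⟫-·V f c ((a , x) ∷ v) = begin
  (c *P a) * f x + ⟪ f , c ·V v ⟫ ≡⟨ ≡.cong (λ ca → ca * f x + ⟪ f , c ·V v ⟫) (*P≡* c a) ⟩
  c * a * f x + ⟪ f , c ·V v ⟫    ≈⟨ +-cong (*-assoc c a (f x)) (⟪⟫-·V f c v) ⟩
  c * (a * f x) + c * ⟪ f , v ⟫   ≈⟨ distribˡ c _ _ ⟨
  c * (a * f x + ⟪ f , v ⟫)       ∎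

⟪⟫-linExt : ∀ f g v → ⟪ f , linExt g v ⟫ ≈ ⟪ f ⋆ g , v ⟫
⟪⟫-linExt f g []            = refl
⟪⟫-linExt f g ((c , x) ∷ v) = begin
  ⟪ f , (c ·V g x) ++ linExt g v ⟫         ≈⟨ ⟪⟫-++ f (c ·V g x) (linExt g v) ⟩
  ⟪ f , c ·V g x ⟫ + ⟪ f , linExt g v ⟫    ≈⟨ +-cong (⟪⟫-·V f c (g x)) (⟪⟫-linExt f g v) ⟩
  c * (f ⋆ g) x + ⟪ f ⋆ g , v ⟫            ∎

⟪⟫-singleton : ∀ f x → ⟪ f , [ (1# , x) ] ⟫ ≈ f x
⟪⟫-singleton f x = trans (+-identityʳ _) (*-identityˡ (f x))

δ : Basis → Basis → Poly
δ (n , d) (n' , d') = if (n' ≡ᵇ n) ∧ (d' ≡ᵇ d) then 1# else 0#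

coeffV-⟪⟫ : ∀ v t → coeffV v t ≈ ⟪ δ t , v ⟫
coeffV-⟪⟫ []                     t       = refl
coeffV-⟪⟫ ((c , (n' , d')) ∷ v) (n , d) with (n' ≡ᵇ n) ∧ (d' ≡ᵇ d)
... | true  = begin
  c +P coeffV v (n , d)           ≡⟨ +P≡+ c _ ⟩
  c + coeffV v (n , d)            ≈⟨ +-cong (sym (*-identityʳ c)) (coeffV-⟪⟫ v (n , d)) ⟩
  c * 1# + ⟪ δ (n , d) , v ⟫      ∎
... | false = begin
  coeffV v (n , d)                ≈⟨ coeffV-⟪⟫ v (n , d) ⟩
  ⟪ δ (n , d) , v ⟫               ≈⟨ +-identityˡ _ ⟨
  0# + ⟪ δ (n , d) , v ⟫          ≈⟨ +-congʳ (zeroʳ c) ⟨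
  c * 0# + ⟪ δ (n , d) , v ⟫      ∎

⟪⟫-pieri-zero : ∀ f e → ⟪ f , pieri 0 e ⟫ ≈ f (0 , e)
⟪⟫-pieri-zero f e = trans (reflexive (≡.cong ⟪ f ,_⟫ (pieri-zero e))) (⟪⟫-singleton f (0 , e))

⟪⟫-pieri-suc : ∀ f b e → ⟪ f , pieri (suc b) e ⟫ ≈ ⟪ f , pieri b (e ℕ.+ 2) ⟫ + f (suc b , e)
⟪⟫-pieri-suc f b e = begin
  ⟪ f , pieri (suc b) e ⟫                                     ≡⟨ ≡.cong ⟪ f ,_⟫ (pieri-suc b e) ⟩
  ⟪ f , pieri b (e ℕ.+ 2) ++ [ (1# , (suc b , e)) ] ⟫         ≈⟨ ⟪⟫-++ f (pieri b (e ℕ.+ 2)) _ ⟩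
  ⟪ f , pieri b (e ℕ.+ 2) ⟫ + ⟪ f , [ (1# , (suc b , e)) ] ⟫  ≈⟨ +-congˡ (⟪⟫-singleton f (suc b , e)) ⟩
  ⟪ f , pieri b (e ℕ.+ 2) ⟫ + f (suc b , e)                   ∎

-- S_{m+1}S_{n+1} = S_{m+2}S_n + S_{m+1,n+1}, where m = n + d.
⟪⟫-pieri-pair : ∀ f c₁ c₂ n d →
  ⟪ f , (c₁ ·V pieri (n ℕ.+ 1) d) ++ (c₂ ·V pieri n (d ℕ.+ 2)) ⟫
  ≈ (c₁ + c₂) * ⟪ f , pieri n (d ℕ.+ 2) ⟫ + c₁ * f (suc n , d)
⟪⟫-pieri-pair f c₁ c₂ n d = begin
  ⟪ f , (c₁ ·V V₁) ++ (c₂ ·V W) ⟫                   ≈⟨ ⟪⟫-++ f (c₁ ·V V₁) (c₂ ·V W) ⟩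
  ⟪ f , c₁ ·V V₁ ⟫ + ⟪ f , c₂ ·V W ⟫                ≈⟨ +-cong (⟪⟫-·V f c₁ V₁) (⟪⟫-·V f c₂ W) ⟩
  c₁ * ⟪ f , V₁ ⟫ + c₂ * ⟪ f , W ⟫
    ≡⟨ ≡.cong (λ k → c₁ * ⟪ f , pieri k d ⟫ + c₂ * ⟪ f , W ⟫) (ℕ.+-comm n 1) ⟩
  c₁ * ⟪ f , pieri (suc n) d ⟫ + c₂ * ⟪ f , W ⟫     ≈⟨ +-congʳ (*-congˡ (⟪⟫-pieri-suc f n d)) ⟩
  c₁ * (⟪ f , W ⟫ + f (suc n , d)) + c₂ * ⟪ f , W ⟫
    ≈⟨ solve 4 (λ c₁ c₂ X Y → c₁ :* (X :+ Y) :+ c₂ :* X := (c₁ :+ c₂) :* X :+ c₁ :* Y)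
               refl c₁ c₂ ⟪ f , W ⟫ (f (suc n , d)) ⟩
  (c₁ + c₂) * ⟪ f , W ⟫ + c₁ * f (suc n , d)        ∎
  where
  V₁ = pieri (n ℕ.+ 1) d
  W  = pieri n (d ℕ.+ 2)

⋆B0basis : ∀ f n d {N} → qpow n ≡ N → let D = qpow d in
  (f ⋆ B0basis) (n , d) ≈ (b0₁ N D + b0₂ N D) * ⟪ f , pieri n (d ℕ.+ 2) ⟫ + b0₁ N D * f (suc n , d)
⋆B0basis f n d ≡.refl = trans (reflexive (≡.cong ⟪ f ,_⟫ (B0basis-≡ n d))) (⟪⟫-pieri-pair f _ _ n d)

⋆B1basis : ∀ f n d {N} → qpow n ≡ N → let D = qpow d in
  (f ⋆ B1basis) (n , d) ≈ (b1₁ N D + b1₂ N D) * ⟪ f , pieri n (d ℕ.+ 2) ⟫ + b1₁ N D * f (suc n , d)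
⋆B1basis f n d ≡.refl = trans (reflexive (≡.cong ⟪ f ,_⟫ (B1basis-≡ n d))) (⟪⟫-pieri-pair f _ _ n d)

Γ : (Basis → Poly) → ℕ → ℕ → Poly
Γ f b e = (1# - qpow b) * (1# - qpow b * qpow e) * ⟪ f , pieri b e ⟫

pencil : (Basis → Poly) → Poly → Basis → Poly
pencil f c x = (f ⋆ B1basis) x + c * (f ⋆ B0basis) x

pencil-identity : ∀ N D W S →
  (b1₁ N D + b1₂ N D) * W + b1₁ N D * S + N * N * D * q * ((b0₁ N D + b0₂ N D) * W + b0₁ N D * S)
  ≈ N * N * D * q * ((1# - q * N) * (1# - q * N * D) * (W + S) - (1# - N) * (1# - N * (D * (q * q))) * W)
pencil-identity N D W S = solve 5 (λ N D q W S →
    (:b1₁ q N D :+ :b1₂ q N D) :* W :+ :b1₁ q N D :* S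
      :+ N :* N :* D :* q :* ((:b0₁ q N D :+ :b0₂ q N D) :* W :+ :b0₁ q N D :* S)
    := N :* N :* D :* q :* ((con 1ℚ :- q :* N) :* (con 1ℚ :- q :* N :* D) :* (W :+ S)
                              :- (con 1ℚ :- N) :* (con 1ℚ :- N :* (D :* (q :* q))) :* W))
  refl N D q W S

pencil-on-basis : ∀ f k d {w} → k ℕ.+ k ℕ.+ d ℕ.+ 1 ≡ w →
  pencil f (qpow w) (k , d) ≈ qpow w * (Γ f (suc k) d - Γ f k (d ℕ.+ 2))
pencil-on-basis f k d ≡.refl = begin
  (f ⋆ B1basis) (k , d) + qpow (k ℕ.+ k ℕ.+ d ℕ.+ 1) * (f ⋆ B0basis) (k , d)
    ≈⟨ +-cong (⋆B1basis f k d ≡.refl) (*-cong (reflexive (qpow-k+k+d+1 k d)) (⋆B0basis f k d ≡.refl)) ⟩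
  (b1₁ N D + b1₂ N D) * W + b1₁ N D * S + N * N * D * q * ((b0₁ N D + b0₂ N D) * W + b0₁ N D * S)
    ≈⟨ pencil-identity N D W S ⟩
  N * N * D * q * ((1# - q * N) * (1# - q * N * D) * (W + S) - (1# - N) * (1# - N * (D * (q * q))) * W)
    ≈⟨ *-cong (reflexive (qpow-k+k+d+1 k d)) (+-cong Γ-top (-‿cong Γ-bottom)) ⟨
  qpow (k ℕ.+ k ℕ.+ d ℕ.+ 1) * (Γ f (suc k) d - Γ f k (d ℕ.+ 2)) ∎
  where
  N = qpow k
  D = qpow d
  W = ⟪ f , pieri k (d ℕ.+ 2) ⟫
  S = f (suc k , d)
  Γ-top : Γ f (suc k) d ≈ (1# - q * N) * (1# - q * N * D) * (W + S)
  Γ-top = trans (reflexive (≡.cong (λ M → (1# - M) * (1# - M * D) * ⟪ f , pieri (suc k) d ⟫) (qpow-suc k)))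
                (*-congˡ (⟪⟫-pieri-suc f k d))
  Γ-bottom : Γ f k (d ℕ.+ 2) ≈ (1# - N) * (1# - N * (D * (q * q))) * W
  Γ-bottom = reflexive (≡.cong (λ E → (1# - N) * (1# - N * E) * W) (qpow-+2 d))

Γ-zero : ∀ f e → Γ f 0 e ≈ 0#
Γ-zero f e = trans (*-congʳ (trans (*-congʳ (-‿inverseʳ 1#)) (zeroˡ _))) (zeroˡ _)

weight-suc : ∀ b e → b ℕ.+ b ℕ.+ (e ℕ.+ 2) ℕ.+ 1 ≡ suc b ℕ.+ suc b ℕ.+ e ℕ.+ 1
weight-suc = solve-∀

pencil-on-pieri : ∀ f b e {w} → b ℕ.+ b ℕ.+ e ℕ.+ 1 ≡ w →
  ⟪ pencil f (qpow w) , pieri b e ⟫ ≈ qpow w * Γ f (suc b) e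
pencil-on-pieri f zero e {w} w≡ = begin
  ⟪ pencil f (qpow w) , pieri 0 e ⟫        ≈⟨ ⟪⟫-pieri-zero (pencil f (qpow w)) e ⟩
  pencil f (qpow w) (0 , e)                ≈⟨ pencil-on-basis f 0 e w≡ ⟩
  qpow w * (Γ f 1 e - Γ f 0 (e ℕ.+ 2))     ≈⟨ *-congˡ (+-congˡ (trans (-‿cong (Γ-zero f (e ℕ.+ 2))) -0#≈0#)) ⟩
  qpow w * (Γ f 1 e + 0#)                  ≈⟨ *-congˡ (+-identityʳ _) ⟩
  qpow w * Γ f 1 e                         ∎
  where open RingProperties ring using (-0#≈0#)
pencil-on-pieri f (suc b) e {w} w≡ = begin
  ⟪ pencil f (qpow w) , pieri (suc b) e ⟫
    ≈⟨ ⟪⟫-pieri-suc (pencil f (qpow w)) b e ⟩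
  ⟪ pencil f (qpow w) , pieri b (e ℕ.+ 2) ⟫ + pencil f (qpow w) (suc b , e)
    ≈⟨ +-cong (pencil-on-pieri f b (e ℕ.+ 2) (≡.trans (weight-suc b e) w≡)) (pencil-on-basis f (suc b) e w≡) ⟩
  qpow w * Γ f (suc b) (e ℕ.+ 2) + qpow w * (Γ f (suc (suc b)) e - Γ f (suc b) (e ℕ.+ 2))
    ≈⟨ solve 3 (λ w x y → w :* x :+ w :* (y :- x) := w :* y) refl (qpow w) _ _ ⟩
  qpow w * Γ f (suc (suc b)) e ∎

B1-on-pieri : ∀ f b e → let w = qpow (b ℕ.+ b ℕ.+ e ℕ.+ 1) in
  ⟪ f ⋆ B1basis , pieri b e ⟫ ≈ w * Γ f (suc b) e - w * ⟪ f ⋆ B0basis , pieri b e ⟫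
B1-on-pieri f b e = begin
  X                                   ≈⟨ solve 2 (λ x y → x := x :+ y :- y) refl X (w * Y) ⟩
  X + w * Y - w * Y                   ≈⟨ +-congʳ (trans (⟪⟫-+ˡ _ _ P) (+-congˡ (⟪⟫-*ˡ w (f ⋆ B0basis) P))) ⟨
  ⟪ pencil f w , P ⟫ - w * Y          ≈⟨ +-congʳ (pencil-on-pieri f b e ≡.refl) ⟩
  w * Γ f (suc b) e - w * Y           ∎
  where
  w = qpow (b ℕ.+ b ℕ.+ e ℕ.+ 1)
  P = pieri b e
  X = ⟪ f ⋆ B1basis , P ⟫
  Y = ⟪ f ⋆ B0basis , P ⟫

commutation-identity : ∀ N D Y I S → let w = N * N * (D * (q * q)) * q ; M = q * N in
  (b0₁ N D + b0₂ N D) * (w * ((1# - M) * (1# - M * (D * (q * q))) * I) - w * Y)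
    + b0₁ N D * ((b1₁ M D + b1₂ M D) * I + b1₁ M D * S)
  ≈ q * ((b1₁ N D + b1₂ N D) * Y + b1₁ N D * ((b0₁ M D + b0₂ M D) * I + b0₁ M D * S))
commutation-identity N D Y I S = solve 6 (λ N D q Y I S →
  let w = N :* N :* (D :* (q :* q)) :* q ; M = q :* N in
  (:b0₁ q N D :+ :b0₂ q N D) :* (w :* ((con 1ℚ :- M) :* (con 1ℚ :- M :* (D :* (q :* q))) :* I) :- w :* Y)
    :+ :b0₁ q N D :* ((:b1₁ q M D :+ :b1₂ q M D) :* I :+ :b1₁ q M D :* S)
  := q :* ((:b1₁ q N D :+ :b1₂ q N D) :* Y :+ :b1₁ q N D :* ((:b0₁ q M D :+ :b0₂ q M D) :* I :+ :b0₁ q M D :* S)))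
  refl N D q Y I S

dual-commutation : ∀ f x → ((f ⋆ B1basis) ⋆ B0basis) x ≈ q * ((f ⋆ B0basis) ⋆ B1basis) x
dual-commutation f (n , d) = begin
  ⟪ f ⋆ B1basis , B0basis (n , d) ⟫
    ≈⟨ ⋆B0basis (f ⋆ B1basis) n d ≡.refl ⟩
  (b0₁ N D + b0₂ N D) * ⟪ f ⋆ B1basis , W ⟫ + b0₁ N D * (f ⋆ B1basis) (suc n , d)
    ≈⟨ +-cong (*-congˡ (B1-on-pieri f n (d ℕ.+ 2))) (*-congˡ (⋆B1basis f (suc n) d (qpow-suc n))) ⟩
  (b0₁ N D + b0₂ N D) * (qpow (n ℕ.+ n ℕ.+ (d ℕ.+ 2) ℕ.+ 1) * Γ f (suc n) (d ℕ.+ 2)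
                          - qpow (n ℕ.+ n ℕ.+ (d ℕ.+ 2) ℕ.+ 1) * Y)
    + b0₁ N D * ((b1₁ (q * N) D + b1₂ (q * N) D) * I + b1₁ (q * N) D * S)
    ≈⟨ +-congʳ (*-congˡ (+-cong (*-cong weight Γ-ring) (-‿cong (*-congʳ weight)))) ⟩
  (b0₁ N D + b0₂ N D) * (w * ((1# - q * N) * (1# - q * N * (D * (q * q))) * I) - w * Y)
    + b0₁ N D * ((b1₁ (q * N) D + b1₂ (q * N) D) * I + b1₁ (q * N) D * S)
    ≈⟨ commutation-identity N D Y I S ⟩
  q * ((b1₁ N D + b1₂ N D) * Y + b1₁ N D * ((b0₁ (q * N) D + b0₂ (q * N) D) * I + b0₁ (q * N) D * S))
    ≈⟨ *-congˡ (trans (⋆B1basis (f ⋆ B0basis) n d ≡.refl) (+-congˡ (*-congˡ (⋆B0basis f (suc n) d (qpow-suc n))))) ⟨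
  q * ⟪ f ⋆ B0basis , B1basis (n , d) ⟫ ∎
  where
  N = qpow n
  D = qpow d
  W = pieri n (d ℕ.+ 2)
  Y = ⟪ f ⋆ B0basis , W ⟫
  I = ⟪ f , pieri (suc n) (d ℕ.+ 2) ⟫
  S = f (suc (suc n) , d)
  w = N * N * (D * (q * q)) * q
  weight : qpow (n ℕ.+ n ℕ.+ (d ℕ.+ 2) ℕ.+ 1) ≈ w
  weight = reflexive (≡.trans (qpow-k+k+d+1 n (d ℕ.+ 2)) (≡.cong (λ E → N * N * E * q) (qpow-+2 d)))
  Γ-ring : Γ f (suc n) (d ℕ.+ 2) ≈ (1# - q * N) * (1# - q * N * (D * (q * q))) * I
  Γ-ring = reflexive (≡.cong₂ (λ M E → (1# - M) * (1# - M * E) * I) (qpow-suc n) (qpow-+2 d))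

mainTheorem12 : ∀ (v : V) → B1 (B0 v) ≈V (qP ·V B0 (B1 v))
mainTheorem12 v t = coeff-≡ (begin
  coeffV (B1 (B0 v)) t                           ≈⟨ coeffV-⟪⟫ (B1 (B0 v)) t ⟩
  ⟪ δ t , B1 (B0 v) ⟫                            ≈⟨ ⟪⟫-linExt (δ t) B1basis (B0 v) ⟩
  ⟪ δ t ⋆ B1basis , B0 v ⟫                       ≈⟨ ⟪⟫-linExt (δ t ⋆ B1basis) B0basis v ⟩
  ⟪ δ t ⋆ B1basis ⋆ B0basis , v ⟫                ≈⟨ ⟪⟫-cong v (dual-commutation (δ t)) ⟩
  ⟪ (λ x → q * (δ t ⋆ B0basis ⋆ B1basis) x) , v ⟫ ≈⟨ ⟪⟫-*ˡ q (δ t ⋆ B0basis ⋆ B1basis) v ⟩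
  q * ⟪ δ t ⋆ B0basis ⋆ B1basis , v ⟫            ≈⟨ *-congˡ (⟪⟫-linExt (δ t ⋆ B0basis) B1basis v) ⟨
  q * ⟪ δ t ⋆ B0basis , B1 v ⟫                   ≈⟨ *-congˡ (⟪⟫-linExt (δ t) B0basis (B1 v)) ⟨
  q * ⟪ δ t , B0 (B1 v) ⟫                        ≈⟨ ⟪⟫-·V (δ t) q (B0 (B1 v)) ⟨
  ⟪ δ t , q ·V B0 (B1 v) ⟫                       ≈⟨ coeffV-⟪⟫ (q ·V B0 (B1 v)) t ⟨
  coeffV (q ·V B0 (B1 v)) t                      ∎)
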